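{- Consider an instance of UJSSP in which there is $k>0$ with $r_j\pi_j=k$ for all $j\in J$, and assume the jobs are numbered so that $\pi_1\ge\pi_2\ge\dots\ge\pi_n$. Let $S=\{j_1,\dots,j_{m}\}\subseteq J$ with $m\ge 1$ and $j_1<j_2<\dots<j_m$ be an optimal solution (i.e. $z(S)=\max_{S'\subseteq J}z(S')$). Then: (1) $S$ contains a job $j$ with $c_j=\min_{l\in J}c_l$; and (2) for every $i\in\{1,\dots,m-1\}$, $S$ contains a job $j$ with $j>j_i$ and $c_j=\min_{l\in J,\,l>j_i}c_l$.
   Context: UJSSP (Unreliable Job Selection and Sequencing Problem): there is a set $J=\{1,\dots,n\}$ of jobs; job $j$ has a cost $c_j\ge 0$, a reward $r_j\ge 0$, and a success probability $\pi_j\in[0,1]$. For a subset $S\subseteq J$ and a sequence $\sigma$ of the jobs of $S$ (with $\sigma(k)$ the $k$-th job), the expected net profit is $z(S,\sigma)=\sum_{k=1}^{|S|} r_{\sigma(k)}\prod_{i=1}^{k}\pi_{\sigma(i)}-\sum_{j\in S}c_j$. Let $z(S)=\max_\sigma z(S,\sigma)$ (with $z(\emptyset)=0$). UJSSP asks for $S\subseteq J$ maximizing $z(S)$.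
   Formalization: The costs c_j, rewards r_j, success probabilities π_j and the constant k are rational numbers. -}

module Defs where

open import Data.Nat using (ℕ; zero; suc)
open import Data.Fin using (Fin)
open import Data.Fin.Subset using (Subset; outside; inside)
import Data.Fin.Subset as Sub
open import Data.Vec using (Vec; []; _∷_)
open import Data.List using (List; []; _∷_)
open import Data.List.Relation.Unary.Unique.Propositional using (Unique)
import Data.List.Membership.Propositional as L
open import Data.Rational using (ℚ; 0ℚ; 1ℚ; _+_; _*_; _-_; _≤_)
open import Data.Product using (Σ; _×_; ∃)
open import Function.Bundles using (_⇔_)
open import Relation.Binary.PropositionalEquality using (_≡_)

costOf : ∀ {n} → (Fin n → ℚ) → Subset n → ℚ
costOf {zero}  c []             = 0ℚ
costOf {suc n} c (outside ∷ S)  = costOf (λ j → c (Fin.suc j)) S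
  where import Data.Fin as Fin
costOf {suc n} c (inside ∷ S)   = c Fin.zero + costOf (λ j → c (Fin.suc j)) S
  where import Data.Fin as Fin

-- rewardAux acc σ = Σ_k r_{σ(k)} * acc * Π_{i ≤ k} π_{σ(i)}
rewardAux : ∀ {n} → (r π : Fin n → ℚ) → ℚ → List (Fin n) → ℚ
rewardAux r π acc []      = 0ℚ
rewardAux r π acc (j ∷ σ) = r j * (acc * π j) + rewardAux r π (acc * π j) σ

IsSequence : ∀ {n} → Subset n → List (Fin n) → Set
IsSequence {n} S σ = Unique σ × ((j : Fin n) → (j L.∈ σ) ⇔ (j Sub.∈ S))

zSeq : ∀ {n} → (c r π : Fin n → ℚ) → Subset n → List (Fin n) → ℚ
zSeq c r π S σ = rewardAux r π 1ℚ σ - costOf c S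

IsZ : ∀ {n} → (c r π : Fin n → ℚ) → Subset n → ℚ → Set
IsZ {n} c r π S v =
  (∃ λ σ → IsSequence S σ × zSeq c r π S σ ≡ v) ×
  ((σ : List (Fin n)) → IsSequence S σ → zSeq c r π S σ ≤ v)


Optimal : ∀ {n} → (c r π : Fin n → ℚ) → Subset n → Set
Optimal {n} c r π S =
  ∃ λ v → IsZ c r π S v ×
    ((S' : Subset n) (v' : ℚ) → IsZ c r π S' v' → v' ≤ v)

-- Let y be the last job of S; as π is antitone, π y is minimal on S. Since r j * π j = k, a job
-- run after a prefix that succeeds with probability a earns exactly k * a. Hence moving y to the
-- end of an optimal sequence of S cannot lower the reward, and the last position earns the same
-- whichever job occupies it. If some j ∉ S had c j < c y, replacing y by j there would strictly
-- increase the profit; so every job cheaper than y lies in S. For both claims, take a cheapest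
-- candidate if it lies in S, and y otherwise: y is itself a candidate, being after every job of
-- S but the last.
module Submission where

open import Defs
open import Data.Nat using (ℕ; zero; suc; s≤s) renaming (_≤_ to _≤ℕ_)
import Data.Nat.Properties as ℕ
open import Data.Fin using (Fin; zero; suc; _≟_)
import Data.Fin as F
import Data.Fin.Properties as F
open import Data.Fin.Subset using (Subset; inside; outside; _∈_; _∉_; Nonempty)
open import Data.Fin.Subset.Properties using (_∈?_)
open import Data.Vec using (_∷_; _[_]≔_)
open import Data.Vec.Properties
  using ([]=-injective; []=⇒lookup; lookup⇒[]=; []≔-updates; []≔-minimal; []≔-lookup; lookup∘update′)
open import Data.Bool.Properties using (¬-not)
open import Data.List
  using (List; []; _∷_; [_]; _++_; _∷ʳ_; length; lookup; allFin; filter; cartesianProductWith)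
open import Data.List.Properties using (++-identityʳ; ∷ʳ-++)
import Data.List.Membership.Propositional as List
open import Data.List.Membership.Propositional using (lose)
open import Data.List.Membership.Propositional.Properties
  using (∈-allFin; ∈-filter⁺; ∈-cartesianProductWith⁺; ∈-lookup; ∈-∃++; ∈-++⁺ʳ)
import Data.List.Membership.DecPropositional as DecMembership
open import Data.List.Relation.Unary.Any as Any using (here; there)
open import Data.List.Relation.Unary.All as All using (All; []; _∷_)
open import Data.List.Relation.Unary.All.Properties using (all-filter; ¬Any⇒All¬)
open import Data.List.Relation.Unary.AllPairs using (_∷_)
open import Data.List.Relation.Unary.Unique.Propositional using (Unique)
open import Data.List.Relation.Unary.Unique.DecPropositional using (unique?)
open import Data.List.Relation.Binary.Permutation.Propositional using (_↭_; ↭-sym; ↭⇒↭ₛ)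
open import Data.List.Relation.Binary.Permutation.Propositional.Properties
  using (∈-resp-↭; shift; ∷↭∷ʳ)
import Data.List.Relation.Binary.Permutation.Setoid.Properties as Permutationₛ
import Data.List.Extrema as Extrema
open import Data.Rational using (ℚ; 0ℚ; 1ℚ; _+_; _*_; _-_; _≤_; _<_; nonNegative)
open import Data.Rational.Properties
  using ( ≤-trans; ≤-reflexive; ≮⇒≥; <⇒≤; <-irrefl; <-≤-trans; ≤-decTotalOrder
        ; +-mono-≤; +-monoʳ-≤; +-monoˡ-<; +-mono-≤-<; neg-antimono-<
        ; *-monoˡ-≤-nonNeg; nonNeg*nonNeg⇒nonNeg
        ; nonNegative⁻¹; +-0-commutativeMonoid; *-1-commutativeMonoid; module ≤-Reasoning )
open import Algebra.Bundles using (CommutativeMonoid)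
import Algebra.Properties.CommutativeSemigroup as CommutativeSemigroupProperties
open import Data.Product using (∃; _×_; _,_; proj₁; proj₂)
open import Data.Sum using (inj₂)
open import Function using (_∘_; id)
open import Function.Bundles using (_⇔_; mk⇔; Equivalence)
open import Relation.Binary.Bundles using (TotalOrder; DecTotalOrder)
import Relation.Binary.Construct.Flip.EqAndOrd as Flip
open import Relation.Binary.PropositionalEquality
  using (_≡_; _≢_; refl; sym; trans; cong; setoid; module ≡-Reasoning)
open import Relation.Nullary using (Dec; yes; no; contradiction)
open import Relation.Nullary.Decidable using (map′; _×-dec_; _→-dec_)
open import Relation.Unary using (Pred; Decidable)
open import Relation.Unary.Properties using (U?)
open import Level using (Level)

open Equivalence using (to; from)

private
  variable
    a p : Level
    n : ℕ

module _ {b ℓ₁ ℓ₂} (O : TotalOrder b ℓ₁ ℓ₂) where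
  open TotalOrder O using (Carrier) renaming (_≤_ to _⊑_; refl to ⊑-refl)
  open Extrema O using (argmin; argmin-all; f[argmin]≤v⁺)

  argmin-enumerated : {A : Set a} {P : Pred A p} → Decidable P →
                      (xs : List A) → (∀ {x} → P x → x List.∈ xs) →
                      (f : A → Carrier) → ∃ P → ∃ λ x → P x × (∀ y → P y → f x ⊑ f y)
  argmin-enumerated P? xs enumerates f (x₀ , Px₀) =
    m , argmin-all f Px₀ (all-filter P? xs) ,
    λ y Py → f[argmin]≤v⁺ x₀ ys (inj₂ (lose (∈-filter⁺ P? (enumerates Py) Py) ⊑-refl))
    where
      ys = filter P? xs
      m = argmin f x₀ ys

lists≤ : ℕ → List (List (Fin n))
lists≤     zero    = [ [] ]
lists≤ {n} (suc d) = [] ∷ cartesianProductWith _∷_ (allFin n) (lists≤ d)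

∈-lists≤ : ∀ {d} (σ : List (Fin n)) → length σ ≤ℕ d → σ List.∈ lists≤ d
∈-lists≤ {d = zero}  []      _         = here refl
∈-lists≤ {d = suc d} []      _         = here refl
∈-lists≤ {d = suc d} (j ∷ σ) (s≤s |σ|≤d) =
  there (∈-cartesianProductWith⁺ _∷_ (∈-allFin j) (∈-lists≤ σ |σ|≤d))

Unique⇒lookup-injective : ∀ {A : Set a} {xs : List A} → Unique xs →
                          ∀ i j → lookup xs i ≡ lookup xs j → i ≡ j
Unique⇒lookup-injective (_  ∷ _) zero    zero    _  = refl
Unique⇒lookup-injective (x∉ ∷ _) zero    (suc j) eq = contradiction eq (All.lookup x∉ (∈-lookup j))
Unique⇒lookup-injective (x∉ ∷ _) (suc i) zero    eq = contradiction (sym eq) (All.lookup x∉ (∈-lookup i))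
Unique⇒lookup-injective (_  ∷ u) (suc i) (suc j) eq = cong suc (Unique⇒lookup-injective u i j eq)

Unique⇒length≤ : {σ : List (Fin n)} → Unique σ → length σ ≤ℕ n
Unique⇒length≤ {σ = σ} u = ℕ.≮⇒≥ λ n<|σ| →
  let i , j , i<j , eq = F.pigeonhole n<|σ| (lookup σ)
  in F.<⇒≢ i<j (Unique⇒lookup-injective u i j eq)

_⇔-dec_ : ∀ {A B : Set} → Dec A → Dec B → Dec (A ⇔ B)
A? ⇔-dec B? = map′ (λ (f , g) → mk⇔ f g) (λ e → to e , from e) ((A? →-dec B?) ×-dec (B? →-dec A?))

IsSequence? : (S : Subset n) → Decidable (IsSequence S)
IsSequence? S σ = unique? _≟_ σ ×-dec F.all? λ j → DecMembership._∈?_ _≟_ j σ ⇔-dec (j ∈? S)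

ℚ-totalOrder : TotalOrder _ _ _
ℚ-totalOrder = DecTotalOrder.totalOrder ≤-decTotalOrder

IsZ-exists : (c r π : Fin n → ℚ) {S : Subset n} {σ : List (Fin n)} → IsSequence S σ →
             ∃ (IsZ c r π S)
IsZ-exists {n} c r π {S} seq
  with argmin-enumerated (Flip.totalOrder ℚ-totalOrder) (IsSequence? S) (lists≤ n)
                         (λ {σ} → ∈-lists≤ σ ∘ Unique⇒length≤ ∘ proj₁) (zSeq c r π S) (_ , seq)
... | best , best-seq , best-max = zSeq c r π S best , (best , best-seq , refl) , best-max

module _ {S : Subset n} where

  ∈-[]≔⁻ : ∀ {x j b} → x ≢ j → x ∈ S [ j ]≔ b → x ∈ S
  ∈-[]≔⁻ {x} x≢j x∈ = lookup⇒[]= x S (trans (sym (lookup∘update′ x≢j S _)) ([]=⇒lookup x∈))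

  ∉-[]≔outside : ∀ {x} → x ∉ S [ x ]≔ outside
  ∉-[]≔outside {x} x∈ with () ← []=-injective x∈ ([]≔-updates S x)

  ∉-[]≔outside⁺ : ∀ {x y} → x ∉ S → x ∉ S [ y ]≔ outside
  ∉-[]≔outside⁺ {x} {y} x∉S with x ≟ y
  ... | yes refl = ∉-[]≔outside
  ... | no x≢y   = x∉S ∘ ∈-[]≔⁻ x≢y

  ∈⇒[]≔inside-id : ∀ {x} → x ∈ S → S [ x ]≔ inside ≡ S
  ∈⇒[]≔inside-id {x} x∈S = trans (cong (S [ x ]≔_) (sym ([]=⇒lookup x∈S))) ([]≔-lookup S x)

  ∉⇒[]≔outside-id : ∀ {x} → x ∉ S → S [ x ]≔ outside ≡ S
  ∉⇒[]≔outside-id {x} x∉S =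
    trans (cong (S [ x ]≔_) (sym (¬-not (x∉S ∘ lookup⇒[]= x S)))) ([]≔-lookup S x)

  IsSequence-resp-↭ : ∀ {σ τ} → IsSequence S σ → σ ↭ τ → IsSequence S τ
  IsSequence-resp-↭ (u , mem) σ↭τ =
    Permutationₛ.Unique-resp-↭ (setoid _) (↭⇒↭ₛ σ↭τ) u ,
    λ x → mk⇔ (to (mem x) ∘ ∈-resp-↭ (↭-sym σ↭τ)) (∈-resp-↭ σ↭τ ∘ from (mem x))

  IsSequence-uncons : ∀ {y τ} → IsSequence S (y ∷ τ) → IsSequence (S [ y ]≔ outside) τ
  IsSequence-uncons {y} {τ} (y∉τ ∷ u , mem) = u , λ x → mk⇔ (τ⇒S⁻ x) (S⁻⇒τ x)
    where
      τ⇒S⁻ : ∀ x → x List.∈ τ → x ∈ S [ y ]≔ outside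
      τ⇒S⁻ x x∈τ = []≔-minimal S x y (All.lookup y∉τ x∈τ ∘ sym) (to (mem x) (there x∈τ))

      S⁻⇒τ : ∀ x → x ∈ S [ y ]≔ outside → x List.∈ τ
      S⁻⇒τ x x∈S⁻ = Any.tail x≢y (from (mem x) (∈-[]≔⁻ x≢y x∈S⁻))
        where
          x≢y : x ≢ y
          x≢y refl = ∉-[]≔outside x∈S⁻

  IsSequence-cons : ∀ {j τ} → j ∉ S → IsSequence S τ → IsSequence (S [ j ]≔ inside) (j ∷ τ)
  IsSequence-cons {j} {τ} j∉S (u , mem) =
    ¬Any⇒All¬ τ (j∉S ∘ to (mem j)) ∷ u , λ x → mk⇔ (jτ⇒S⁺ x) (S⁺⇒jτ x)
    where
      jτ⇒S⁺ : ∀ x → x List.∈ j ∷ τ → x ∈ S [ j ]≔ inside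
      jτ⇒S⁺ x (here refl) = []≔-updates S j
      jτ⇒S⁺ x (there x∈τ) = []≔-minimal S x j (λ { refl → j∉S x∈S }) x∈S
        where x∈S = to (mem x) x∈τ

      S⁺⇒jτ : ∀ x → x ∈ S [ j ]≔ inside → x List.∈ j ∷ τ
      S⁺⇒jτ x x∈S⁺ with x ≟ j
      ... | yes refl = here refl
      ... | no x≢j   = there (from (mem x) (∈-[]≔⁻ x≢j x∈S⁺))

costOf-[]≔ : (c : Fin n → ℚ) (S : Subset n) (j : Fin n) →
             costOf c (S [ j ]≔ inside) ≡ c j + costOf c (S [ j ]≔ outside)
costOf-[]≔ c (_       ∷ S) zero    = refl
costOf-[]≔ c (outside ∷ S) (suc j) = costOf-[]≔ (c ∘ suc) S j
costOf-[]≔ c (inside  ∷ S) (suc j) = begin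
  c zero + costOf (c ∘ suc) (S [ j ]≔ inside)
    ≡⟨ cong (c zero +_) (costOf-[]≔ (c ∘ suc) S j) ⟩
  c zero + (c (suc j) + costOf (c ∘ suc) (S [ j ]≔ outside))
    ≡⟨ x∙yz≈y∙xz (c zero) (c (suc j)) _ ⟩
  c (suc j) + (c zero + costOf (c ∘ suc) (S [ j ]≔ outside)) ∎
  where
    open ≡-Reasoning
    open CommutativeSemigroupProperties (CommutativeMonoid.commutativeSemigroup +-0-commutativeMonoid)
      using (x∙yz≈y∙xz)

costOf-remove : (c : Fin n → ℚ) {S : Subset n} {y : Fin n} → y ∈ S →
                costOf c S ≡ c y + costOf c (S [ y ]≔ outside)
costOf-remove c {S} {y} y∈S =
  trans (cong (costOf c) (sym (∈⇒[]≔inside-id y∈S))) (costOf-[]≔ c S y)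

costOf-insert : (c : Fin n → ℚ) {S : Subset n} {j : Fin n} → j ∉ S →
                costOf c (S [ j ]≔ inside) ≡ c j + costOf c S
costOf-insert c {S} {j} j∉S =
  trans (costOf-[]≔ c S j) (cong (λ S′ → c j + costOf c S′) (∉⇒[]≔outside-id j∉S))

*-nonNeg : ∀ {x y} → 0ℚ ≤ x → 0ℚ ≤ y → 0ℚ ≤ x * y
*-nonNeg {x} {y} 0≤x 0≤y =
  nonNegative⁻¹ (x * y) {{nonNeg*nonNeg⇒nonNeg x {{nonNegative 0≤x}} y {{nonNegative 0≤y}}}}

module Reward (r π : Fin n → ℚ) (k : ℚ) (r*π≡k : ∀ j → r j * π j ≡ k)
              (π≥0 : ∀ j → 0ℚ ≤ π j) (k≥0 : 0ℚ ≤ k) where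

  open CommutativeSemigroupProperties (CommutativeMonoid.commutativeSemigroup *-1-commutativeMonoid)
    using (x∙yz≈xz∙y; xy∙z≈xz∙y)

  R : ℚ → List (Fin n) → ℚ
  R = rewardAux r π

  R-∷ : ∀ a j σ → R a (j ∷ σ) ≡ k * a + R (a * π j) σ
  R-∷ a j σ = cong (_+ R (a * π j) σ) (begin
    r j * (a * π j) ≡⟨ x∙yz≈xz∙y (r j) a (π j) ⟩
    r j * π j * a   ≡⟨ cong (_* a) (r*π≡k j) ⟩
    k * a           ∎)
    where open ≡-Reasoning

  R-∷ʳ : ∀ a σ x y → R a (σ ∷ʳ x) ≡ R a (σ ∷ʳ y)
  R-∷ʳ a []      x y = trans (R-∷ a x []) (sym (R-∷ a y []))
  R-∷ʳ a (j ∷ σ) x y = cong (r j * (a * π j) +_) (R-∷ʳ (a * π j) σ x y)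

  R-++-monoʳ : ∀ {σ τ} → (∀ a → 0ℚ ≤ a → R a σ ≤ R a τ) →
               ∀ ρ a → 0ℚ ≤ a → R a (ρ ++ σ) ≤ R a (ρ ++ τ)
  R-++-monoʳ σ≤τ []      a 0≤a = σ≤τ a 0≤a
  R-++-monoʳ σ≤τ (j ∷ ρ) a 0≤a =
    +-monoʳ-≤ (r j * (a * π j)) (R-++-monoʳ σ≤τ ρ (a * π j) (*-nonNeg 0≤a (π≥0 j)))

  R-swap : ∀ {x y} → π x ≤ π y → ∀ σ a → 0ℚ ≤ a → R a (x ∷ y ∷ σ) ≤ R a (y ∷ x ∷ σ)
  R-swap {x} {y} πx≤πy σ a 0≤a = begin
    R a (x ∷ y ∷ σ)                               ≡⟨ R-∷∷ x y ⟩
    k * a + (k * (a * π x) + R (a * π x * π y) σ) ≤⟨ +-monoʳ-≤ (k * a) (+-mono-≤ first≤ rest≤) ⟩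
    k * a + (k * (a * π y) + R (a * π y * π x) σ) ≡⟨ sym (R-∷∷ y x) ⟩
    R a (y ∷ x ∷ σ)                               ∎
    where
      open ≤-Reasoning
      R-∷∷ : ∀ u v → R a (u ∷ v ∷ σ) ≡ k * a + (k * (a * π u) + R (a * π u * π v) σ)
      R-∷∷ u v = trans (R-∷ a u (v ∷ σ)) (cong (k * a +_) (R-∷ (a * π u) v σ))

      first≤ : k * (a * π x) ≤ k * (a * π y)
      first≤ = *-monoˡ-≤-nonNeg k {{nonNegative k≥0}} (*-monoˡ-≤-nonNeg a {{nonNegative 0≤a}} πx≤πy)

      rest≤ : R (a * π x * π y) σ ≤ R (a * π y * π x) σ
      rest≤ = ≤-reflexive (cong (λ t → R t σ) (xy∙z≈xz∙y a (π x) (π y)))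

  R-sink : ∀ ρ y σ → All (λ b → π y ≤ π b) σ →
           ∀ a → 0ℚ ≤ a → R a (ρ ++ y ∷ σ) ≤ R a ((ρ ++ σ) ∷ʳ y)
  R-sink ρ y []      _               a 0≤a =
    ≤-reflexive (cong (λ ρ′ → R a (ρ′ ∷ʳ y)) (sym (++-identityʳ ρ)))
  R-sink ρ y (b ∷ σ) (πy≤πb ∷ πy≤πσ) a 0≤a = begin
    R a (ρ ++ y ∷ b ∷ σ)     ≤⟨ R-++-monoʳ (R-swap πy≤πb σ) ρ a 0≤a ⟩
    R a (ρ ++ b ∷ y ∷ σ)     ≡⟨ cong (R a) (sym (∷ʳ-++ ρ b (y ∷ σ))) ⟩
    R a (ρ ∷ʳ b ++ y ∷ σ)    ≤⟨ R-sink (ρ ∷ʳ b) y σ πy≤πσ a 0≤a ⟩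
    R a ((ρ ∷ʳ b ++ σ) ∷ʳ y) ≡⟨ cong (λ ρ′ → R a (ρ′ ∷ʳ y)) (∷ʳ-++ ρ b σ) ⟩
    R a ((ρ ++ b ∷ σ) ∷ʳ y)  ∎
    where open ≤-Reasoning

  module _ {S : Subset n} {y j : Fin n}
           (y∈S : y ∈ S) (π-y≤ : ∀ b → b ∈ S → π y ≤ π b) (j∉S : j ∉ S) where

    S′ : Subset n
    S′ = (S [ y ]≔ outside) [ j ]≔ inside

    exchange-sequence : ∀ {σ} → IsSequence S σ →
                        ∃ λ σ′ → IsSequence S′ σ′ × R 1ℚ σ ≤ R 1ℚ σ′
    exchange-sequence seq@(_ , mem) with ∈-∃++ (from (mem y) y∈S)
    ... | ρ , τ , refl = (ρ ++ τ) ∷ʳ j , seq′ , R≤R′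
      where
        seq′ : IsSequence S′ ((ρ ++ τ) ∷ʳ j)
        seq′ = IsSequence-resp-↭ (IsSequence-cons (∉-[]≔outside⁺ j∉S) seq⁻) (∷↭∷ʳ j (ρ ++ τ))
          where seq⁻ = IsSequence-uncons (IsSequence-resp-↭ seq (shift y ρ τ))

        π-y≤τ : All (λ b → π y ≤ π b) τ
        π-y≤τ = All.tabulate λ {b} b∈τ → π-y≤ b (to (mem b) (∈-++⁺ʳ ρ (there b∈τ)))

        R≤R′ : R 1ℚ (ρ ++ y ∷ τ) ≤ R 1ℚ ((ρ ++ τ) ∷ʳ j)
        R≤R′ = ≤-trans (R-sink ρ y τ π-y≤τ 1ℚ (nonNegative⁻¹ 1ℚ))
                       (≤-reflexive (R-∷ʳ 1ℚ (ρ ++ τ) y j))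

    exchange : (c : Fin n → ℚ) → c j < c y → ∀ {σ} → IsSequence S σ →
               ∃ λ σ′ → IsSequence S′ σ′ × zSeq c r π S σ < zSeq c r π S′ σ′
    exchange c cj<cy {σ} seq with exchange-sequence seq
    ... | σ′ , seq′ , R≤R′ = σ′ , seq′ , (begin-strict
      R 1ℚ σ - costOf c S   ≡⟨ cong (R 1ℚ σ -_) (costOf-remove c y∈S) ⟩
      R 1ℚ σ - (c y + C⁻)   <⟨ +-mono-≤-< R≤R′ (neg-antimono-< (+-monoˡ-< C⁻ cj<cy)) ⟩
      R 1ℚ σ′ - (c j + C⁻)  ≡⟨ cong (R 1ℚ σ′ -_) (sym (costOf-insert c (∉-[]≔outside⁺ j∉S))) ⟩
      R 1ℚ σ′ - costOf c S′ ∎)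
      where
        open ≤-Reasoning
        C⁻ = costOf c (S [ y ]≔ outside)

optimal-sequence : {c r π : Fin n → ℚ} {S : Subset n} → Optimal c r π S →
                   ∃ λ σ → IsSequence S σ ×
                     (∀ S′ σ′ → IsSequence S′ σ′ → zSeq c r π S′ σ′ ≤ zSeq c r π S σ)
optimal-sequence {c = c} {r} {π} (_ , ((σ , seq , refl) , _) , z≤v) = σ , seq , λ S′ σ′ seq′ →
  let v′ , isZ′ = IsZ-exists c r π seq′ in ≤-trans (proj₂ isZ′ σ′ seq′) (z≤v S′ v′ isZ′)

Nonempty⇒max : (S : Subset n) → Nonempty S → ∃ λ y → y ∈ S × (∀ b → b ∈ S → b F.≤ y)
Nonempty⇒max S =
  argmin-enumerated (Flip.totalOrder (F.≤-totalOrder _)) (_∈? S) (allFin _) (λ {x} _ → ∈-allFin x) id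

module OptimalSolution {c r π : Fin n → ℚ} {k : ℚ} (r*π≡k : ∀ j → r j * π j ≡ k)
                       (π≥0 : ∀ j → 0ℚ ≤ π j) (k≥0 : 0ℚ ≤ k)
                       {S : Subset n} (opt : Optimal c r π S)
                       {y : Fin n} (y∈S : y ∈ S) (π-y≤ : ∀ b → b ∈ S → π y ≤ π b) where

  open Reward r π k r*π≡k π≥0 k≥0 using (exchange)

  j∉S⇒c[y]≤c[j] : ∀ {j} → j ∉ S → c y ≤ c j
  j∉S⇒c[y]≤c[j] j∉S = ≮⇒≥ λ cj<cy →
    let σ , seq , σ-max = optimal-sequence opt
        σ′ , seq′ , z<z′ = exchange y∈S π-y≤ j∉S c cj<cy seq
    in <-irrefl refl (<-≤-trans z<z′ (σ-max _ σ′ seq′))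

  cheapest-in-optimal : {P : Pred (Fin n) p} → Decidable P → P y →
                        ∃ λ j → j ∈ S × P j × (∀ l → P l → c j ≤ c l)
  cheapest-in-optimal P? Py
    with argmin-enumerated ℚ-totalOrder P? (allFin n) (λ {x} _ → ∈-allFin x) c (y , Py)
  ... | j , Pj , j-min with j ∈? S
  ...   | yes j∈S = j , j∈S , Pj , j-min
  ...   | no  j∉S = y , y∈S , Py , λ l Pl → ≤-trans (j∉S⇒c[y]≤c[j] j∉S) (j-min l Pl)

lemma1 : (n : ℕ) (c r π : Fin n → ℚ) (k : ℚ) →
    ((j : Fin n) → 0ℚ ≤ c j) →
    ((j : Fin n) → 0ℚ ≤ r j) →
    ((j : Fin n) → 0ℚ ≤ π j × π j ≤ 1ℚ) →
    0ℚ < k →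
    ((j : Fin n) → r j * π j ≡ k) →
    ((i j : Fin n) → i F.≤ j → π j ≤ π i) →
    (S : Subset n) → Nonempty S → Optimal c r π S →
    (∃ λ j → j ∈ S × ((l : Fin n) → c j ≤ c l)) ×
    ((i : Fin n) → i ∈ S → (∃ λ i' → i' ∈ S × i F.< i') →
      ∃ λ j → j ∈ S × i F.< j × ((l : Fin n) → i F.< l → c j ≤ c l))
lemma1 n c r π k _ _ π∈[0,1] 0<k r*π≡k π-antitone S S≠∅ opt
  with y , y∈S , y-max ← Nonempty⇒max S S≠∅ =
  let open OptimalSolution r*π≡k (proj₁ ∘ π∈[0,1]) (<⇒≤ 0<k) opt y∈S
                           (λ b b∈S → π-antitone b y (y-max b b∈S))
  in (λ (j , j∈S , _ , j-min) → j , j∈S , λ l → j-min l _) (cheapest-in-optimal U? _) ,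
     λ i _ (i′ , i′∈S , i<i′) → cheapest-in-optimal (i F.<?_) (ℕ.<-≤-trans i<i′ (y-max i′ i′∈S))
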